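{- Let $G=(\mathcal{A}\cup\mathcal{B},E)$ be a bipartite graph with a set $\mathcal{C}\subseteq\mathcal{A}\cup\mathcal{B}$ of critical vertices. Let $N$ be any critical matching in $G$ and $M$ be any matching in $G$. Then the number of vertices of $\mathcal{A}\cap\mathcal{C}$ matched in $N$ is at least the number of vertices of $\mathcal{A}\cap\mathcal{C}$ matched in $M$. Similarly, the number of vertices of $\mathcal{B}\cap\mathcal{C}$ matched in $N$ is at least the number of vertices of $\mathcal{B}\cap\mathcal{C}$ matched in $M$.
   Context: A matching is a set of edges of $G$ sharing no endpoint. A matching $N$ is critical if no matching in $G$ matches strictly more vertices of $\mathcal{C}$ (in total, over both sides) than $N$ does. -}

module Defs where

open import Data.Nat using (ℕ; _+_; _≤_)
open import Data.Fin using (Fin; _≟_)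
open import Data.Fin.Subset using (Subset; _∈_)
open import Data.Fin.Subset.Properties using (_∈?_)
open import Data.Product using (_×_; _,_; proj₁; proj₂)
open import Data.List using (List; []; _∷_)
open import Data.List.Relation.Unary.All using (All)
open import Data.List.Relation.Unary.Any using (Any; any?)
open import Relation.Binary.PropositionalEquality using (_≡_)
open import Relation.Nullary using (¬_; Dec; _×-dec_)
open import Relation.Nullary.Decidable using (⌊_⌋)
open import Data.Bool using (Bool; true; false; if_then_else_)

EdgesOf : {a b : ℕ} → (Fin a → Fin b → Set) → List (Fin a × Fin b) → Set
EdgesOf E M = All (λ e → E (proj₁ e) (proj₂ e)) M

-- No two (list-distinct positions of) edges share an endpoint.
-- This also forbids listing the same edge twice, so M is a set of edges.
data Disjoint {a b : ℕ} : List (Fin a × Fin b) → Set where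
  []  : Disjoint []
  _∷_ : {e : Fin a × Fin b} {M : List (Fin a × Fin b)} →
        All (λ f → ¬ (proj₁ e ≡ proj₁ f) × ¬ (proj₂ e ≡ proj₂ f)) M →
        Disjoint M → Disjoint (e ∷ M)

IsMatching : {a b : ℕ} → (Fin a → Fin b → Set) → List (Fin a × Fin b) → Set
IsMatching E M = EdgesOf E M × Disjoint M

MatchedA : {a b : ℕ} → List (Fin a × Fin b) → Fin a → Set
MatchedA M u = Any (λ e → proj₁ e ≡ u) M

MatchedB : {a b : ℕ} → List (Fin a × Fin b) → Fin b → Set
MatchedB M v = Any (λ e → proj₂ e ≡ v) M

matchedA? : {a b : ℕ} (M : List (Fin a × Fin b)) (u : Fin a) → Dec (MatchedA M u)
matchedA? M u = any? (λ e → proj₁ e ≟ u) M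

matchedB? : {a b : ℕ} (M : List (Fin a × Fin b)) (v : Fin b) → Dec (MatchedB M v)
matchedB? M v = any? (λ e → proj₂ e ≟ v) M

countFin : (n : ℕ) → (Fin n → Bool) → ℕ
countFin ℕ.zero p = 0
countFin (ℕ.suc n) p = (if p Fin.zero then 1 else 0) + countFin n (λ i → p (Fin.suc i))

matchedCritA : {a b : ℕ} → Subset a → List (Fin a × Fin b) → ℕ
matchedCritA {a} CA M = countFin a (λ u → ⌊ (u ∈? CA) ×-dec matchedA? M u ⌋)

matchedCritB : {a b : ℕ} → Subset b → List (Fin a × Fin b) → ℕ
matchedCritB {b = b} CB M = countFin b (λ v → ⌊ (v ∈? CB) ×-dec matchedB? M v ⌋)

matchedCrit : {a b : ℕ} → Subset a → Subset b → List (Fin a × Fin b) → ℕ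
matchedCrit CA CB M = matchedCritA CA M + matchedCritB CB M

IsCritical : {a b : ℕ} → (Fin a → Fin b → Set) → Subset a → Subset b →
             List (Fin a × Fin b) → Set
IsCritical {a} {b} E CA CB N =
  IsMatching E N ×
  ((M : List (Fin a × Fin b)) → IsMatching E M → matchedCrit CA CB M ≤ matchedCrit CA CB N)

-- Mendelsohn–Dulmage: for matchings M and N there is a matching K matching every
-- vertex of A matched by M and every vertex of B matched by N.  Writing critA and
-- critB for the numbers of matched critical vertices on each side, criticality of N gives
--   critA M + critB N ≤ critA K + critB K ≤ critA N + critB N,
-- so critA M ≤ critA N; exchanging the roles of M and N gives critB M ≤ critB N.
-- K is obtained from N by inserting the edges (x , y) of M one at a time: x takes y
-- from its partner x′ in K, and if x′ is matched in M its M-edge is inserted in turn.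
-- Vertices of B are never unmatched, and the chain of displacements ends because
-- each step adds an edge of M to K and removes none.
module Submission where

open import Defs
open import Data.Nat using (ℕ; zero; suc; _≤_; _<_; z≤n; s≤s)
open import Data.Nat.Properties
  using (≤-trans; ≤-pred; n<1+n; +-mono-≤; +-cancelʳ-≤; +-cancelˡ-≤; m≤n⇒m≤1+n; m<n⇒m<1+n)
open import Data.Fin using (Fin; _≟_)
open import Data.Fin.Subset using (Subset)
open import Data.Fin.Subset.Properties using (_∈?_)
open import Data.Product using (_×_; _,_; proj₁; proj₂; ∃)
open import Data.Product.Properties using (≡-dec)
open import Data.List using (List; []; _∷_; filter)
open import Data.List.Relation.Unary.All as All using (All; []; _∷_)
open import Data.List.Relation.Unary.Any using (here; there)
open import Data.List.Membership.Propositional using (_∈_; _∉_; find; lose)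
open import Data.List.Membership.Propositional.Properties using (∈-filter⁺; ∈-filter⁻)
open import Data.List.Relation.Binary.Sublist.Propositional using (_⊆_; []; _∷_; _∷ʳ_)
open import Data.List.Relation.Binary.Sublist.Propositional.Properties using (All-resp-⊆; filter-⊆)
open import Data.Bool using (Bool; true; false; T)
open import Data.Empty using (⊥-elim)
open import Function using (_∘_)
open import Relation.Binary.Definitions using (DecidableEquality)
open import Relation.Binary.PropositionalEquality using (_≡_; _≢_; refl; sym; cong; subst)
open import Relation.Nullary using (¬_; Dec; yes; no; ¬?; _×-dec_)
open import Relation.Nullary.Decidable using (toWitness; fromWitness)

countFin-mono : ∀ n {p q : Fin n → Bool} → (∀ i → T (p i) → T (q i)) → countFin n p ≤ countFin n q
countFin-mono zero h = z≤n
countFin-mono (suc n) {p} {q} h with p Fin.zero | q Fin.zero | h Fin.zero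
... | true  | true  | _  = s≤s (countFin-mono n (h ∘ Fin.suc))
... | true  | false | h₀ = ⊥-elim (h₀ _)
... | false | true  | _  = m≤n⇒m≤1+n (countFin-mono n (h ∘ Fin.suc))
... | false | false | _  = countFin-mono n (h ∘ Fin.suc)

matchedCritA-mono : {a b : ℕ} (CA : Subset a) {M K : List (Fin a × Fin b)} →
                    (∀ {u} → MatchedA M u → MatchedA K u) → matchedCritA CA M ≤ matchedCritA CA K
matchedCritA-mono {a} CA {M} {K} M⊆K = countFin-mono a λ u t →
  let u∈CA , uM = toWitness {a? = (u ∈? CA) ×-dec matchedA? M u} t
  in fromWitness {a? = (u ∈? CA) ×-dec matchedA? K u} (u∈CA , M⊆K uM)

matchedCritB-mono : {a b : ℕ} (CB : Subset b) {M K : List (Fin a × Fin b)} →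
                    (∀ {v} → MatchedB M v → MatchedB K v) → matchedCritB CB M ≤ matchedCritB CB K
matchedCritB-mono {b = b} CB {M} {K} M⊆K = countFin-mono b λ v t →
  let v∈CB , vM = toWitness {a? = (v ∈? CB) ×-dec matchedB? M v} t
  in fromWitness {a? = (v ∈? CB) ×-dec matchedB? K v} (v∈CB , M⊆K vM)

module Missing {A : Set} (_≟ᴬ_ : DecidableEquality A) where
  open import Data.List.Membership.DecPropositional _≟ᴬ_ using () renaming (_∈?_ to _∈ᴸ?_)

  missing : List A → List A → ℕ
  missing [] K = 0
  missing (e ∷ L) K with e ∈ᴸ? K
  ... | yes _ = missing L K
  ... | no  _ = suc (missing L K)

  missing-mono : ∀ L {K K′} → (∀ {e} → e ∈ L → e ∈ K → e ∈ K′) → missing L K′ ≤ missing L K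
  missing-mono [] h = z≤n
  missing-mono (e ∷ L) {K} {K′} h with e ∈ᴸ? K | e ∈ᴸ? K′
  ... | yes e∈K | yes _    = missing-mono L (h ∘ there)
  ... | yes e∈K | no  e∉K′ = ⊥-elim (e∉K′ (h (here refl) e∈K))
  ... | no  _   | yes _    = m≤n⇒m≤1+n (missing-mono L (h ∘ there))
  ... | no  _   | no  _    = s≤s (missing-mono L (h ∘ there))

  missing-< : ∀ L {K K′} → (∀ {e} → e ∈ L → e ∈ K → e ∈ K′) →
              ∀ {e} → e ∈ L → e ∈ K′ → e ∉ K → missing L K′ < missing L K
  missing-< (e ∷ L) {K} {K′} h (here refl) e∈K′ e∉K with e ∈ᴸ? K | e ∈ᴸ? K′
  ... | yes e∈K | _       = ⊥-elim (e∉K e∈K)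
  ... | no  _   | yes _   = s≤s (missing-mono L (h ∘ there))
  ... | no  _   | no e∉K′ = ⊥-elim (e∉K′ e∈K′)
  missing-< (f ∷ L) {K} {K′} h (there e∈L) e∈K′ e∉K with f ∈ᴸ? K | f ∈ᴸ? K′
  ... | yes _   | yes _    = missing-< L (h ∘ there) e∈L e∈K′ e∉K
  ... | yes f∈K | no  f∉K′ = ⊥-elim (f∉K′ (h (here refl) f∈K))
  ... | no  _   | yes _    = m<n⇒m<1+n (missing-< L (h ∘ there) e∈L e∈K′ e∉K)
  ... | no  _   | no  _    = s≤s (missing-< L (h ∘ there) e∈L e∈K′ e∉K)

module _ {a b : ℕ} where

  Disjoint-resp-⊆ : {K K′ : List (Fin a × Fin b)} → K ⊆ K′ → Disjoint K′ → Disjoint K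
  Disjoint-resp-⊆ []        []      = []
  Disjoint-resp-⊆ (_ ∷ʳ τ)  (_ ∷ d) = Disjoint-resp-⊆ τ d
  Disjoint-resp-⊆ (refl ∷ τ) (h ∷ d) = All-resp-⊆ τ h ∷ Disjoint-resp-⊆ τ d

  Disjoint⇒proj₂-injective : {K : List (Fin a × Fin b)} → Disjoint K →
                             ∀ {e f} → e ∈ K → f ∈ K → proj₂ e ≡ proj₂ f → e ≡ f
  Disjoint⇒proj₂-injective (h ∷ d) (here refl) (here refl) eq = refl
  Disjoint⇒proj₂-injective (h ∷ d) (here refl) (there f∈K) eq = ⊥-elim (proj₂ (All.lookup h f∈K) eq)
  Disjoint⇒proj₂-injective (h ∷ d) (there e∈K) (here refl) eq = ⊥-elim (proj₂ (All.lookup h e∈K) (sym eq))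
  Disjoint⇒proj₂-injective (h ∷ d) (there e∈K) (there f∈K) eq = Disjoint⇒proj₂-injective d e∈K f∈K eq

  avoids? : (y : Fin b) (e : Fin a × Fin b) → Dec (proj₂ e ≢ y)
  avoids? y e = ¬? (proj₂ e ≟ y)

  rematch : Fin a → Fin b → List (Fin a × Fin b) → List (Fin a × Fin b)
  rematch x y K = (x , y) ∷ filter (avoids? y) K

  rematch-⊇ : ∀ {x y K e} → e ∈ K → proj₂ e ≢ y → e ∈ rematch x y K
  rematch-⊇ {y = y} e∈K e≢y = there (∈-filter⁺ (avoids? y) e∈K e≢y)

  rematch-isMatching : ∀ {E : Fin a → Fin b → Set} {x y K} →
                       IsMatching E K → E x y → ¬ MatchedA K x → IsMatching E (rematch x y K)
  rematch-isMatching {x = x} {y} {K} (edges , disjoint) xy x∉K =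
    xy ∷ All-resp-⊆ kept⊆K edges ,
    All.tabulate (λ e∈ → let e∈K , e≢y = ∈-filter⁻ (avoids? y) {xs = K} e∈
                         in (λ x≡ → x∉K (lose e∈K (sym x≡))) , (λ y≡ → e≢y (sym y≡)))
      ∷ Disjoint-resp-⊆ kept⊆K disjoint
    where
    kept⊆K = filter-⊆ (avoids? y) K

  rematch-coversB : ∀ {x y K v} → MatchedB K v → MatchedB (rematch x y K) v
  rematch-coversB {y = y} {v = v} vK with v ≟ y
  ... | yes refl = here refl
  ... | no  v≢y with find vK
  ...   | e , e∈K , refl = lose (rematch-⊇ e∈K v≢y) refl

  rematch-keepsA : ∀ {x y K z} → MatchedA K z → (z , y) ∉ K → MatchedA (rematch x y K) z
  rematch-keepsA {y = y} zK zy∉K with find zK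
  ... | (z , y′) , zy′∈K , refl with y′ ≟ y
  ...   | yes refl = ⊥-elim (zy∉K zy′∈K)
  ...   | no  y′≢y = lose (rematch-⊇ zy′∈K y′≢y) refl

module Insertion {a b : ℕ} (E : Fin a → Fin b → Set)
                 {M : List (Fin a × Fin b)} (M-matching : IsMatching E M) where
  open Missing (≡-dec (_≟_ {a}) (_≟_ {b}))

  record _≼_ (K K′ : List (Fin a × Fin b)) : Set where
    field
      isMatching : IsMatching E K′
      coversB    : ∀ {v} → MatchedB K v → MatchedB K′ v
      keepsA     : ∀ {z} → MatchedA M z → MatchedA K z → MatchedA K′ z
  open _≼_

  ≼-refl : ∀ {K} → IsMatching E K → K ≼ K
  ≼-refl mK = record { isMatching = mK ; coversB = λ p → p ; keepsA = λ _ p → p }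

  ≼-trans : ∀ {K K′ K″} → K ≼ K′ → K′ ≼ K″ → K ≼ K″
  ≼-trans p q = record { isMatching = isMatching q
                       ; coversB = coversB q ∘ coversB p
                       ; keepsA = λ zM → keepsA q zM ∘ keepsA p zM }

  Inserted : List (Fin a × Fin b) → Fin a → Set
  Inserted K x = ∃ λ K′ → K ≼ K′ × MatchedA K′ x

  -- missing M K decreases along a chain of displacements, so it bounds the recursion depth
  insert : ∀ n K → IsMatching E K → missing M K < n → ∀ {x y} → (x , y) ∈ M → Inserted K x
  insert zero    K mK () xy∈M
  insert (suc n) K mK fuel {x} {y} xy∈M with matchedA? K x
  ... | yes xK  = K , ≼-refl mK , xK
  ... | no  x∉K = displace (matchedB? K y)
    where
    K′ = rematch x y K

    K′-matching : IsMatching E K′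
    K′-matching = rematch-isMatching mK (All.lookup (proj₁ M-matching) xy∈M) x∉K

    M∩K⊆K′ : ∀ {e} → e ∈ M → e ∈ K → e ∈ K′
    M∩K⊆K′ {e} e∈M e∈K with proj₂ e ≟ y
    ... | yes e₂≡y =
      subst (_∈ K′) (sym (Disjoint⇒proj₂-injective (proj₂ M-matching) e∈M xy∈M e₂≡y)) (here refl)
    ... | no  e₂≢y = rematch-⊇ e∈K e₂≢y

    K′-fuel : missing M K′ < n
    K′-fuel = ≤-trans (missing-< M M∩K⊆K′ xy∈M (here refl) (λ xy∈K → x∉K (lose xy∈K refl))) (≤-pred fuel)

    K≼K′ : (∀ {z} → MatchedA M z → (z , y) ∉ K) → K ≼ K′
    K≼K′ spared = record { isMatching = K′-matching
                         ; coversB = rematch-coversB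
                         ; keepsA = λ zM zK → rematch-keepsA zK (spared zM) }

    displace : Dec (MatchedB K y) → Inserted K x
    displace (no y∉K) = K′ , K≼K′ (λ _ zy∈K → y∉K (lose zy∈K refl)) , here refl
    displace (yes yK) with find yK
    ... | (x′ , _) , x′y∈K , refl = reinsert (matchedA? M x′)
      where
      partner : ∀ {z} → (z , y) ∈ K → z ≡ x′
      partner zy∈K = cong proj₁ (Disjoint⇒proj₂-injective (proj₂ mK) zy∈K x′y∈K refl)

      reinsert : Dec (MatchedA M x′) → Inserted K x
      reinsert (no x′∉M) = K′ , K≼K′ (λ zM zy∈K → x′∉M (subst (MatchedA M) (partner zy∈K) zM)) , here refl
      reinsert (yes x′M) with find x′M
      ... | (_ , y′) , x′y′∈M , refl with insert n K′ K′-matching K′-fuel x′y′∈M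
      ...   | K″ , K′≼K″ , x′K″ =
        K″ , record { isMatching = isMatching K′≼K″
                    ; coversB = coversB K′≼K″ ∘ rematch-coversB
                    ; keepsA = keepsA″ } ,
        keepsA K′≼K″ (lose xy∈M refl) (here refl)
        where
        keepsA″ : ∀ {z} → MatchedA M z → MatchedA K z → MatchedA K″ z
        keepsA″ {z} zM zK with z ≟ x′
        ... | yes refl = x′K″
        ... | no  z≢x′ = keepsA K′≼K″ zM (rematch-keepsA zK (z≢x′ ∘ partner))

  insertAll : ∀ L → (∀ {e} → e ∈ L → e ∈ M) → ∀ K → IsMatching E K →
              ∃ λ K′ → K ≼ K′ × (∀ {u} → MatchedA L u → MatchedA K′ u)
  insertAll [] L⊆M K mK = K , ≼-refl mK , λ ()
  insertAll (e ∷ L) L⊆M K mK with insert (suc (missing M K)) K mK (n<1+n _) (L⊆M (here refl))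
  ... | K₁ , K≼K₁ , eK₁ with insertAll L (L⊆M ∘ there) K₁ (isMatching K≼K₁)
  ...   | K₂ , K₁≼K₂ , LK₂ = K₂ , ≼-trans K≼K₁ K₁≼K₂ , covers
    where
    covers : ∀ {u} → MatchedA (e ∷ L) u → MatchedA K₂ u
    covers (here refl) = keepsA K₁≼K₂ (lose (L⊆M (here refl)) refl) eK₁
    covers (there uL)  = LK₂ uL

  mendelsohn-dulmage : ∀ {N} → IsMatching E N →
                       ∃ λ K → IsMatching E K × (∀ {u} → MatchedA M u → MatchedA K u)
                                              × (∀ {v} → MatchedB N v → MatchedB K v)
  mendelsohn-dulmage {N} mN =
    let K , N≼K , M⊆K = insertAll M (λ e∈M → e∈M) N mN
    in K , isMatching N≼K , M⊆K , coversB N≼K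

open Insertion using (mendelsohn-dulmage)

claim2 : {a b : ℕ} (E : Fin a → Fin b → Set) (CA : Subset a) (CB : Subset b)
         (N M : List (Fin a × Fin b)) →
         IsCritical E CA CB N → IsMatching E M →
         (matchedCritA CA M ≤ matchedCritA CA N) × (matchedCritB CB M ≤ matchedCritB CB N)
claim2 E CA CB N M (mN , N-critical) mM = critA-bound , critB-bound
  where
  critA-bound : matchedCritA CA M ≤ matchedCritA CA N
  critA-bound =
    let K , mK , M⊆K , N⊆K = mendelsohn-dulmage E mM mN
    in +-cancelʳ-≤ (matchedCritB CB N) _ _
         (≤-trans (+-mono-≤ (matchedCritA-mono CA M⊆K) (matchedCritB-mono CB N⊆K)) (N-critical K mK))

  critB-bound : matchedCritB CB M ≤ matchedCritB CB N
  critB-bound =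
    let K , mK , N⊆K , M⊆K = mendelsohn-dulmage E mN mM
    in +-cancelˡ-≤ (matchedCritA CA N) _ _
         (≤-trans (+-mono-≤ (matchedCritA-mono CA N⊆K) (matchedCritB-mono CB M⊆K)) (N-critical K mK))
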